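{- Let $s>r\ge 0$, $n=s+r$, and let $\pi\in S_n$ have Robinson–Schensted shape $\lambda=(s,r)$ (two rows, of lengths $s$ and $r$). Then there exists $p\in[n]$ such that the sequence $\pi\setminus\{p\}$ has a longest increasing subsequence of length $s-1$. Moreover, $p$ belongs to every longest increasing subsequence of $\pi$.
   Context: For a permutation $\pi$ in one-line notation and $p\in[n]$, $\pi\setminus\{p\}$ denotes the sequence of length $n-1$ obtained by deleting the entry $p$ from $\pi$. A longest increasing subsequence (LIS) of a sequence is an increasing subsequence of maximal length. -}

module Defs where

open import Data.Nat using (ℕ; zero; suc; _<_; _≤_; _<?_)
open import Data.List using (List; []; _∷_; [_]; length; map; foldl; filter; upTo)
open import Data.List.Relation.Binary.Sublist.Propositional using (_⊆_)
open import Data.List.Relation.Unary.Linked using (Linked)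
open import Data.List.Relation.Binary.Permutation.Propositional using (_↭_)
open import Data.Maybe using (Maybe; just; nothing)
open import Data.Product using (_×_; _,_)
open import Relation.Nullary using (yes; no; ¬?)
open import Relation.Binary.PropositionalEquality using (_≡_)
import Data.Nat as ℕ

-- A permutation of [n] = {1,…,n} in one-line notation.
IsPerm : ℕ → List ℕ → Set
IsPerm n π = π ↭ map suc (upTo n)

delete : ℕ → List ℕ → List ℕ
delete p π = filter (λ x → ¬? (x ℕ.≟ p)) π

IsIncSub : List ℕ → List ℕ → Set
IsIncSub π σ = (σ ⊆ π) × Linked _<_ σ

IsLIS : List ℕ → List ℕ → Set
IsLIS π σ = IsIncSub π σ × (∀ τ → IsIncSub π τ → length τ ≤ length σ)

rowInsert : ℕ → List ℕ → List ℕ × Maybe ℕ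
rowInsert x [] = [ x ] , nothing
rowInsert x (y ∷ ys) with x <? y
... | yes _ = (x ∷ ys) , just y
... | no _ with rowInsert x ys
...   | ys′ , b = (y ∷ ys′) , b

-- Insert x into a tableau (list of rows, top row first).
insertT : ℕ → List (List ℕ) → List (List ℕ)
insertT x [] = [ [ x ] ]
insertT x (row ∷ rows) with rowInsert x row
... | row′ , nothing = row′ ∷ rows
... | row′ , just y  = row′ ∷ insertT y rows

insertionTableau : List ℕ → List (List ℕ)
insertionTableau π = foldl (λ T x → insertT x T) [] π

rsShape : List ℕ → List ℕ
rsShape π = map length (insertionTableau π)

-- The partition (s , r) as a list of its nonzero parts.
twoRowShape : ℕ → ℕ → List ℕ
twoRowShape s zero = s ∷ []
twoRowShape s (suc r) = s ∷ suc r ∷ []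

-- Insert the entries of π one at a time into the first row of the Robinson–Schensted
-- tableau (patience sorting) and give each entry, as its level, the column it lands in.
-- Levels strictly increase along every increasing subsequence and stay below the length s
-- of the first row, and the first row is witnessed by an increasing subsequence of length
-- s. Hence the longest increasing subsequences have length s and meet every level
-- 0, …, s − 1. The n = s + r < 2s entries fill s nonempty levels, so some level holds a
-- single entry p: it lies on every LIS, and after deleting it no increasing subsequence of
-- length s survives, while deleting it from an LIS leaves one of length s − 1.
module Submission where

open import Defs
open import Data.Empty using (⊥-elim)
open import Data.List using (List; []; _∷_; [_]; _++_; length; map; filter; foldl; upTo)
open import Data.List.Properties
  using ( length-++; length-map; length-upTo; filter-++; filter-accept; filter-reject; filter-all
        ; foldl-∷ʳ; ∷-injectiveˡ)
open import Data.List.Membership.Propositional using (_∈_; _∉_)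
open import Data.List.Membership.Propositional.Properties
  using (∈-++⁻; ∈-length; ∈-filter⁺; ∈-filter⁻; ∈-map⁻; ∈-upTo⁻)
open import Data.List.Relation.Unary.Any using (here; there)
open import Data.List.Relation.Unary.All as All using (All; []; _∷_)
import Data.List.Relation.Unary.All.Properties as AllP
open import Data.List.Relation.Unary.AllPairs as AllPairs using (AllPairs; []; _∷_)
open import Data.List.Relation.Unary.Linked using (Linked; []; [-]; _∷_)
import Data.List.Relation.Unary.Linked.Properties as LinkedP
open import Data.List.Relation.Unary.Unique.Propositional using (Unique)
import Data.List.Relation.Unary.Unique.Propositional.Properties as UniqueP
open import Data.List.Relation.Binary.Sublist.Propositional
  using (_⊆_; []; _∷ʳ_; _∷_; ⊆-refl; ⊆-trans; from∈; to∈)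
import Data.List.Relation.Binary.Sublist.Propositional.Properties as SublistP
open import Data.List.Relation.Binary.Permutation.Propositional using (↭-sym; ↭⇒↭ₛ)
open import Data.List.Relation.Binary.Permutation.Propositional.Properties using (↭-length; ∈-resp-↭)
open import Data.List.Reverse using (Reverse; []; _∶_∶ʳ_; reverseView)
open import Data.Maybe using (just; nothing)
open import Data.Nat using (ℕ; zero; suc; _+_; _∸_; _<_; _≤_; _<?_; _≟_; z≤n; s≤s)
open import Data.Nat.Properties
open import Data.Product using (Σ; ∃; ∃₂; _×_; _,_; proj₁; proj₂; map₁)
open import Data.Sum using (_⊎_; inj₁; inj₂)
import Data.Sum as Sum
open import Function using (_on_; _∘_; id)
open import Relation.Nullary using (yes; no; ¬?)
open import Relation.Binary.PropositionalEquality hiding ([_])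
open import Algebra.Properties.CommutativeSemigroup +-commutativeSemigroup
  using () renaming (interchange to +-interchange)
open import Data.List.Relation.Binary.Permutation.Setoid.Properties (setoid ℕ) using (Unique-resp-↭)

variable
  a b j k m p x y w : ℕ
  xs ys π τ R : List ℕ
  f g : ℕ → ℕ

pair-⊆-∷ʳ⁻ : a ∷ b ∷ [] ⊆ xs ++ [ y ] → a ∷ b ∷ [] ⊆ xs ⊎ (a ∈ xs × b ≡ y)
pair-⊆-∷ʳ⁻ {xs = []} (_ ∷ʳ ())
pair-⊆-∷ʳ⁻ {xs = []} (_ ∷ ())
pair-⊆-∷ʳ⁻ {xs = x ∷ xs} (x ∷ʳ ab⊆) = Sum.map (x ∷ʳ_) (map₁ there) (pair-⊆-∷ʳ⁻ ab⊆)
pair-⊆-∷ʳ⁻ {xs = x ∷ xs} (refl ∷ b⊆) with ∈-++⁻ xs (to∈ b⊆)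
... | inj₁ b∈xs = inj₁ (refl ∷ from∈ b∈xs)
... | inj₂ (here b≡y) = inj₂ (here refl , b≡y)

Linked-lift-⊆ : {P Q : ℕ → ℕ → Set} →
  (∀ {a b} → a ∷ b ∷ [] ⊆ ys → P a b → Q a b) → xs ⊆ ys → Linked P xs → Linked Q xs
Linked-lift-⊆ pairs (y ∷ʳ xs⊆) xs↗ = Linked-lift-⊆ (pairs ∘ (y ∷ʳ_)) xs⊆ xs↗
Linked-lift-⊆ pairs [] [] = []
Linked-lift-⊆ pairs (refl ∷ xs⊆) [-] = [-]
Linked-lift-⊆ pairs (refl ∷ xs⊆) (Pab ∷ xs↗) =
  pairs (refl ∷ from∈ (SublistP.Any-resp-⊆ xs⊆ (here refl))) Pab ∷ Linked-lift-⊆ (pairs ∘ (_ ∷ʳ_)) xs⊆ xs↗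

Linked-∷ʳ⁺ : {P : ℕ → ℕ → Set} → Linked P xs → All (λ a → P a y) xs → Linked P (xs ++ [ y ])
Linked-∷ʳ⁺ [] [] = [-]
Linked-∷ʳ⁺ [-] (Pay ∷ []) = Pay ∷ [-]
Linked-∷ʳ⁺ (Pab ∷ xs↗) (_ ∷ P-y) = Pab ∷ Linked-∷ʳ⁺ xs↗ P-y

Unique-∷ʳ⁻ : Unique (xs ++ [ y ]) → Unique xs × y ∉ xs
Unique-∷ʳ⁻ {[]} _ = [] , λ ()
Unique-∷ʳ⁻ {x ∷ xs} (x≢ ∷ u) with AllP.∷ʳ⁻ x≢ | Unique-∷ʳ⁻ u
... | x≢xs , x≢y | u′ , y∉xs = x≢xs ∷ u′ , λ { (here refl) → x≢y refl ; (there y∈xs) → y∉xs y∈xs }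

length≡1⇒singleton : ∀ xs → length xs ≡ 1 → ∃ λ (p : ℕ) → xs ≡ [ p ]
length≡1⇒singleton (p ∷ []) _ = p , refl

∉-delete : ∀ xs → p ∉ delete p xs
∉-delete {p} xs p∈ = proj₂ (∈-filter⁻ (λ x → ¬? (x ≟ p)) {xs = xs} p∈) refl

delete-⊆ : ∀ xs → delete p xs ⊆ xs
delete-⊆ {p} = SublistP.filter-⊆ (λ x → ¬? (x ≟ p))

delete⁺ : xs ⊆ ys → delete p xs ⊆ delete p ys
delete⁺ = SublistP.filter⁺ (λ x → ¬? (x ≟ _)) (λ x → ¬? (x ≟ _)) λ { refl → id }

length-delete : Unique xs → p ∈ xs → suc (length (delete p xs)) ≡ length xs
length-delete {x ∷ xs} {p} (x∉ ∷ _) (here refl) = cong (suc ∘ length) (begin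
  delete p (p ∷ xs) ≡⟨ filter-reject (λ z → ¬? (z ≟ p)) (λ p≢p → p≢p refl) ⟩
  delete p xs       ≡⟨ filter-all (λ z → ¬? (z ≟ p)) (All.map ≢-sym x∉) ⟩
  xs                ∎)
  where open ≡-Reasoning
length-delete {x ∷ xs} {p} (x∉ ∷ u) (there p∈xs) =
  cong suc (trans (cong length (filter-accept (λ z → ¬? (z ≟ p)) (All.lookup x∉ p∈xs))) (length-delete u p∈xs))

insertRow : ℕ → List ℕ → List ℕ
insertRow x [] = [ x ]
insertRow x (y ∷ ys) with x <? y
... | yes _ = x ∷ ys
... | no _ = y ∷ insertRow x ys

bumpIndex : ℕ → List ℕ → ℕ
bumpIndex x [] = 0
bumpIndex x (y ∷ ys) with x <? y
... | yes _ = 0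
... | no _ = suc (bumpIndex x ys)

-- Out of range the entry is the junk value 0; every use below is guarded by an index bound.
_!_ : List ℕ → ℕ → ℕ
[] ! _ = 0
(y ∷ ys) ! zero = y
(y ∷ ys) ! suc k = ys ! k

proj₁-rowInsert : ∀ x R → proj₁ (rowInsert x R) ≡ insertRow x R
proj₁-rowInsert x [] = refl
proj₁-rowInsert x (y ∷ ys) with x <? y
... | yes _ = refl
... | no _ = cong (y ∷_) (proj₁-rowInsert x ys)

All-! : {P : ℕ → Set} → All P xs → k < length xs → P (xs ! k)
All-! {k = zero} (Px ∷ _) _ = Px
All-! {k = suc k} (_ ∷ Pxs) (s≤s k<) = All-! Pxs k<

insertRow-All : {P : ℕ → Set} → P x → All P R → All P (insertRow x R)
insertRow-All Px [] = Px ∷ []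
insertRow-All {x} {y ∷ _} Px (Py ∷ PR) with x <? y
... | yes _ = Px ∷ PR
... | no _ = Py ∷ insertRow-All Px PR

insertRow-sorted : AllPairs _≤_ R → AllPairs _≤_ (insertRow x R)
insertRow-sorted [] = [] ∷ []
insertRow-sorted {y ∷ _} {x} (y≤R ∷ R↗) with x <? y
... | yes x<y = All.map (≤-trans (<⇒≤ x<y)) y≤R ∷ R↗
... | no x≮y = insertRow-All (≮⇒≥ x≮y) y≤R ∷ insertRow-sorted R↗

bumpIndex≤length : ∀ x R → bumpIndex x R ≤ length R
bumpIndex≤length x [] = z≤n
bumpIndex≤length x (y ∷ ys) with x <? y
... | yes _ = z≤n
... | no _ = s≤s (bumpIndex≤length x ys)

bumpIndex<length-insertRow : ∀ x R → bumpIndex x R < length (insertRow x R)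
bumpIndex<length-insertRow x [] = s≤s z≤n
bumpIndex<length-insertRow x (y ∷ ys) with x <? y
... | yes _ = s≤s z≤n
... | no _ = s≤s (bumpIndex<length-insertRow x ys)

length-insertRow-≥ : ∀ x R → length R ≤ length (insertRow x R)
length-insertRow-≥ x [] = z≤n
length-insertRow-≥ x (y ∷ ys) with x <? y
... | yes _ = ≤-refl
... | no _ = s≤s (length-insertRow-≥ x ys)

<length-insertRow⁻ : ∀ x R → k < length (insertRow x R) → k ≢ bumpIndex x R → k < length R
<length-insertRow⁻ {zero} x [] _ k≢i = ⊥-elim (k≢i refl)
<length-insertRow⁻ {suc _} x [] (s≤s ())
<length-insertRow⁻ x (y ∷ ys) k< k≢i with x <? y
... | yes _ = k<
<length-insertRow⁻ {zero} x (y ∷ ys) k< k≢i | no _ = s≤s z≤n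
<length-insertRow⁻ {suc k} x (y ∷ ys) (s≤s k<) k≢i | no _ =
  s≤s (<length-insertRow⁻ x ys k< (k≢i ∘ cong suc))

insertRow-!-bumpIndex : ∀ x R → insertRow x R ! bumpIndex x R ≡ x
insertRow-!-bumpIndex x [] = refl
insertRow-!-bumpIndex x (y ∷ ys) with x <? y
... | yes _ = refl
... | no _ = insertRow-!-bumpIndex x ys

insertRow-!-≢ : ∀ x R → k ≢ bumpIndex x R → insertRow x R ! k ≡ R ! k
insertRow-!-≢ {zero} x [] k≢i = ⊥-elim (k≢i refl)
insertRow-!-≢ {suc _} x [] _ = refl
insertRow-!-≢ x (y ∷ ys) k≢i with x <? y
insertRow-!-≢ {zero} x (y ∷ ys) k≢i | yes _ = ⊥-elim (k≢i refl)
insertRow-!-≢ {suc _} x (y ∷ ys) k≢i | yes _ = refl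
insertRow-!-≢ {zero} x (y ∷ ys) k≢i | no _ = refl
insertRow-!-≢ {suc k} x (y ∷ ys) k≢i | no _ = insertRow-!-≢ x ys (k≢i ∘ cong suc)

insertRow-!-≤ : ∀ x R → k < length R → insertRow x R ! k ≤ R ! k
insertRow-!-≤ x (y ∷ ys) k< with x <? y
insertRow-!-≤ {zero} x (y ∷ ys) _ | yes x<y = <⇒≤ x<y
insertRow-!-≤ {suc _} x (y ∷ ys) _ | yes _ = ≤-refl
insertRow-!-≤ {zero} x (y ∷ ys) _ | no _ = ≤-refl
insertRow-!-≤ {suc k} x (y ∷ ys) (s≤s k<) | no _ = insertRow-!-≤ x ys k<

<bumpIndex⇒!-≤ : ∀ x R → k < bumpIndex x R → R ! k ≤ x
<bumpIndex⇒!-≤ x (y ∷ ys) k<i with x <? y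
<bumpIndex⇒!-≤ {zero} x (y ∷ ys) _ | no x≮y = ≮⇒≥ x≮y
<bumpIndex⇒!-≤ {suc k} x (y ∷ ys) (s≤s k<i) | no _ = <bumpIndex⇒!-≤ x ys k<i

!-≤⇒<bumpIndex : ∀ x R → AllPairs _≤_ R → k < length R → R ! k ≤ x → k < bumpIndex x R
!-≤⇒<bumpIndex {k} x (y ∷ ys) (y≤ys ∷ ys↗) k< Rk≤x with x <? y
... | yes x<y = ⊥-elim (<-irrefl refl (<-≤-trans x<y (≤-trans (head≤ k k<) Rk≤x)))
  where
    head≤ : ∀ k → k < length (y ∷ ys) → y ≤ (y ∷ ys) ! k
    head≤ zero _ = ≤-refl
    head≤ (suc k) (s≤s k<) = All-! y≤ys k<
!-≤⇒<bumpIndex {zero} x (y ∷ ys) _ _ _ | no _ = s≤s z≤n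
!-≤⇒<bumpIndex {suc k} x (y ∷ ys) (_ ∷ ys↗) (s≤s k<) Rk≤x | no _ =
  s≤s (!-≤⇒<bumpIndex x ys ys↗ k< Rk≤x)

firstRow : List (List ℕ) → List ℕ
firstRow [] = []
firstRow (R ∷ _) = R

insertFirstRow : List ℕ → List ℕ
insertFirstRow = foldl (λ R x → insertRow x R) []

firstRow-insertT : ∀ x T → firstRow (insertT x T) ≡ insertRow x (firstRow T)
firstRow-insertT x [] = refl
firstRow-insertT x (R ∷ T) with rowInsert x R | proj₁-rowInsert x R
... | _ , nothing | R′≡ = R′≡
... | _ , just _  | R′≡ = R′≡

firstRow-foldl-insertT : ∀ T π →
  firstRow (foldl (λ T x → insertT x T) T π) ≡ foldl (λ R x → insertRow x R) (firstRow T) π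
firstRow-foldl-insertT T [] = refl
firstRow-foldl-insertT T (x ∷ π) =
  trans (firstRow-foldl-insertT (insertT x T) π)
        (cong (λ R → foldl (λ R x → insertRow x R) R π) (firstRow-insertT x T))

firstRow-insertionTableau : ∀ π → firstRow (insertionTableau π) ≡ insertFirstRow π
firstRow-insertionTableau = firstRow-foldl-insertT []

length-firstRow : ∀ {s r} T → map length T ≡ twoRowShape s r → length (firstRow T) ≡ s
length-firstRow {r = zero} (R ∷ T) shape = ∷-injectiveˡ shape
length-firstRow {r = suc _} (R ∷ T) shape = ∷-injectiveˡ shape

update : (ℕ → ℕ) → ℕ → ℕ → ℕ → ℕ
update f y v a with a ≟ y
... | yes _ = v
... | no _ = f a

update-same : ∀ f y v → update f y v y ≡ v
update-same f y v with y ≟ y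
... | yes _ = refl
... | no y≢y = ⊥-elim (y≢y refl)

update-other : ∀ f y v {a} → a ≢ y → update f y v a ≡ f a
update-other f y v {a} a≢y with a ≟ y
... | yes a≡y = ⊥-elim (a≢y a≡y)
... | no _ = refl

record RowInvariant (α R : List ℕ) (level : ℕ → ℕ) : Set where
  field
    sorted     : AllPairs _≤_ R
    level-<    : ∀ {a} → a ∈ α → level a < length R
    !-level-≤  : ∀ {a} → a ∈ α → R ! level a ≤ a
    -- Stated for pairs because appending y to α only adds pairs ending in y;
    -- Linked-lift-⊆ recovers whole increasing subsequences.
    level-mono : ∀ {a b} → a ∷ b ∷ [] ⊆ α → a < b → level a < level b
    chain      : ∀ {k} → k < length R →
                 ∃ λ σ → IsIncSub α σ × length σ ≡ suc k × All (_≤ R ! k) σ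

rowInvariant-[] : RowInvariant [] [] (λ _ → 0)
rowInvariant-[] = record
  { sorted = [] ; level-< = λ () ; !-level-≤ = λ () ; level-mono = λ () ; chain = λ () }

module _ {α R level y} (I : RowInvariant α R level) (y∉α : y ∉ α) where
  open RowInvariant I

  private
    i : ℕ
    i = bumpIndex y R
    R′ : List ℕ
    R′ = insertRow y R
    level′ : ℕ → ℕ
    level′ = update level y i

    level′-old : a ∈ α → level′ a ≡ level a
    level′-old a∈α = update-other level y i (λ a≡y → y∉α (subst (_∈ α) a≡y a∈α))

    level-<-bumpIndex : b ∈ α → b < y → level b < i
    level-<-bumpIndex b∈α b<y =
      !-≤⇒<bumpIndex y R sorted (level-< b∈α) (≤-trans (!-level-≤ b∈α) (<⇒≤ b<y))

    level-<′ : a ∈ α ++ [ y ] → level′ a < length R′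
    level-<′ a∈ with ∈-++⁻ α a∈
    ... | inj₁ a∈α rewrite level′-old a∈α = <-≤-trans (level-< a∈α) (length-insertRow-≥ y R)
    ... | inj₂ (here refl) rewrite update-same level y i = bumpIndex<length-insertRow y R

    !-level-≤′ : a ∈ α ++ [ y ] → R′ ! level′ a ≤ a
    !-level-≤′ a∈ with ∈-++⁻ α a∈
    ... | inj₁ a∈α rewrite level′-old a∈α = ≤-trans (insertRow-!-≤ y R (level-< a∈α)) (!-level-≤ a∈α)
    ... | inj₂ (here refl) rewrite update-same level y i = ≤-reflexive (insertRow-!-bumpIndex y R)

    level-mono′ : a ∷ b ∷ [] ⊆ α ++ [ y ] → a < b → level′ a < level′ b
    level-mono′ ab⊆ a<b with pair-⊆-∷ʳ⁻ ab⊆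
    ... | inj₁ ab⊆α =
      subst₂ _<_ (sym (level′-old (SublistP.Any-resp-⊆ ab⊆α (here refl))))
                 (sym (level′-old (SublistP.Any-resp-⊆ ab⊆α (there (here refl)))))
                 (level-mono ab⊆α a<b)
    ... | inj₂ (a∈α , refl) =
      subst₂ _<_ (sym (level′-old a∈α)) (sym (update-same level y i)) (level-<-bumpIndex a∈α a<b)

    chain-below-y : k < i → ∃ λ σ → IsIncSub α σ × length σ ≡ suc k × All (_< y) σ
    chain-below-y k<i with chain (<-≤-trans k<i (bumpIndex≤length y R))
    ... | σ , (σ⊆α , σ↗) , len , σ≤Rk = σ , (σ⊆α , σ↗) , len , All.tabulate below-y
      where
        below-y : a ∈ σ → a < y
        below-y a∈σ = ≤∧≢⇒< (≤-trans (All.lookup σ≤Rk a∈σ) (<bumpIndex⇒!-≤ y R k<i))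
                            (λ a≡y → y∉α (subst (_∈ α) a≡y (SublistP.Any-resp-⊆ σ⊆α a∈σ)))

    chain-to-y : ∀ j → j ≤ i → ∃ λ σ → IsIncSub (α ++ [ y ]) σ × length σ ≡ suc j × All (_≤ y) σ
    chain-to-y zero _ = [ y ] , (SublistP.++⁺ˡ α ⊆-refl , [-]) , refl , ≤-refl ∷ []
    chain-to-y (suc k) k<i with chain-below-y k<i
    ... | σ , (σ⊆α , σ↗) , len , σ<y =
      σ ++ [ y ] , (SublistP.++⁺ σ⊆α ⊆-refl , Linked-∷ʳ⁺ σ↗ σ<y) ,
      trans (length-++ σ) (trans (cong (_+ 1) len) (+-comm (suc k) 1)) ,
      AllP.∷ʳ⁺ (All.map <⇒≤ σ<y) ≤-refl

    chain′ : k < length R′ → ∃ λ σ → IsIncSub (α ++ [ y ]) σ × length σ ≡ suc k × All (_≤ R′ ! k) σ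
    chain′ {k} k< with k ≟ i
    ... | yes refl rewrite insertRow-!-bumpIndex y R = chain-to-y i ≤-refl
    ... | no k≢i rewrite insertRow-!-≢ y R k≢i with chain (<length-insertRow⁻ y R k< k≢i)
    ...   | σ , (σ⊆α , σ↗) , len , σ≤ = σ , (SublistP.++⁺ʳ [ y ] σ⊆α , σ↗) , len , σ≤

  rowInvariant-∷ʳ : RowInvariant (α ++ [ y ]) (insertRow y R) (update level y (bumpIndex y R))
  rowInvariant-∷ʳ = record
    { sorted = insertRow-sorted sorted ; level-< = level-<′ ; !-level-≤ = !-level-≤′
    ; level-mono = level-mono′ ; chain = chain′ }

patienceStep : List ℕ × (ℕ → ℕ) → ℕ → List ℕ × (ℕ → ℕ)
patienceStep (R , level) y = insertRow y R , update level y (bumpIndex y R)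

patience : List ℕ → List ℕ × (ℕ → ℕ)
patience = foldl patienceStep ([] , λ _ → 0)

proj₁-foldl-patienceStep : ∀ R level π →
  proj₁ (foldl patienceStep (R , level) π) ≡ foldl (λ R x → insertRow x R) R π
proj₁-foldl-patienceStep R level [] = refl
proj₁-foldl-patienceStep R level (y ∷ π) =
  proj₁-foldl-patienceStep (insertRow y R) (update level y (bumpIndex y R)) π

patience-invariant : Reverse π → Unique π → RowInvariant π (proj₁ (patience π)) (proj₂ (patience π))
patience-invariant [] _ = rowInvariant-[]
patience-invariant (xs ∶ xs-view ∶ʳ y) u rewrite foldl-∷ʳ patienceStep ([] , λ _ → 0) y xs =
  rowInvariant-∷ʳ (patience-invariant xs-view (proj₁ (Unique-∷ʳ⁻ u))) (proj₂ (Unique-∷ʳ⁻ u))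

rowInvariant-longChain : ∀ {α level} → RowInvariant α R level → ∃ λ σ → IsIncSub α σ × length σ ≡ length R
rowInvariant-longChain {[]} _ = [] , (SublistP.[]⊆-universal _ , []) , refl
rowInvariant-longChain {_ ∷ _} I with RowInvariant.chain I ≤-refl
... | σ , inc , len , _ = σ , inc , len

record Levelling (π : List ℕ) (w : ℕ) : Set where
  field
    level            : ℕ → ℕ
    level-<          : ∀ {a} → a ∈ π → level a < w
    level-increasing : ∀ {τ} → IsIncSub π τ → Linked (_<_ on level) τ
    longChain        : ∃ λ σ → IsIncSub π σ × length σ ≡ w

schensted-levelling : Unique π → Levelling π (length (insertFirstRow π))
schensted-levelling {π} u =
  subst (Levelling π) (cong length (proj₁-foldl-patienceStep [] (λ _ → 0) π)) (record
  { level = proj₂ (patience π)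
  ; level-< = level-<
  ; level-increasing = λ (τ⊆π , τ↗) → Linked-lift-⊆ level-mono τ⊆π τ↗
  ; longChain = rowInvariant-longChain I })
  where
    I : RowInvariant π (proj₁ (patience π)) (proj₂ (patience π))
    I = patience-invariant (reverseView π) u
    open RowInvariant I

strictChain-length : ∀ {lo hi} → AllPairs _<_ xs → All (lo ≤_) xs → All (_< hi) xs → lo ≤ hi →
  length xs + lo ≤ hi
strictChain-length [] _ _ lo≤hi = lo≤hi
strictChain-length {x ∷ xs} {lo} {hi} (x<xs ∷ xs↗) (lo≤x ∷ _) (x<hi ∷ xs<hi) _ = begin
  suc (length xs + lo) ≤⟨ s≤s (+-monoʳ-≤ (length xs) lo≤x) ⟩
  suc (length xs + x)  ≡⟨ +-suc (length xs) x ⟨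
  length xs + suc x    ≤⟨ strictChain-length xs↗ x<xs xs<hi x<hi ⟩
  hi                   ∎
  where open ≤-Reasoning

strictChain-∈ : ∀ {lo hi} → AllPairs _<_ xs → All (lo ≤_) xs → All (_< hi) xs →
  length xs + lo ≡ hi → lo ≤ j → j < hi → j ∈ xs
strictChain-∈ [] _ _ refl lo≤j j<lo = ⊥-elim (<-irrefl refl (≤-<-trans lo≤j j<lo))
strictChain-∈ {x ∷ xs} {j} {lo} {hi} (x<xs ∷ xs↗) (lo≤x ∷ _) (x<hi ∷ xs<hi) full lo≤j j<hi
  with ≤-antisym lo≤x x≤lo | m≤n⇒m<n∨m≡n lo≤j
  where
    x≤lo : x ≤ lo
    x≤lo = +-cancelˡ-≤ (length xs) x lo (≤-pred (begin
      suc (length xs + x) ≡⟨ +-suc (length xs) x ⟨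
      length xs + suc x   ≤⟨ strictChain-length xs↗ x<xs xs<hi x<hi ⟩
      hi                  ≡⟨ full ⟨
      suc (length xs + lo) ∎))
      where open ≤-Reasoning
... | refl | inj₂ refl = here refl
... | refl | inj₁ x<j = there (strictChain-∈ xs↗ x<xs xs<hi (trans (+-suc (length xs) x) full) x<j j<hi)

fibre : (ℕ → ℕ) → List ℕ → ℕ → List ℕ
fibre f xs j = filter (λ a → f a ≟ j) xs

sumBelow : ℕ → (ℕ → ℕ) → ℕ
sumBelow zero g = 0
sumBelow (suc w) g = sumBelow w g + g w

sumBelow-+ : ∀ w {g h₁ h₂ : ℕ → ℕ} → (∀ j → g j ≡ h₁ j + h₂ j) →
  sumBelow w g ≡ sumBelow w h₁ + sumBelow w h₂
sumBelow-+ zero _ = refl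
sumBelow-+ (suc w) {g} {h₁} {h₂} g≡ = begin
  sumBelow w g + g w
    ≡⟨ cong₂ _+_ (sumBelow-+ w g≡) (g≡ w) ⟩
  (sumBelow w h₁ + sumBelow w h₂) + (h₁ w + h₂ w)
    ≡⟨ +-interchange (sumBelow w h₁) (sumBelow w h₂) (h₁ w) (h₂ w) ⟩
  (sumBelow w h₁ + h₁ w) + (sumBelow w h₂ + h₂ w) ∎
  where open ≡-Reasoning

sumBelow-zero : ∀ w → (∀ {j} → j < w → g j ≡ 0) → sumBelow w g ≡ 0
sumBelow-zero zero _ = refl
sumBelow-zero {g} (suc w) g≡0 = cong₂ _+_ (sumBelow-zero w (g≡0 ∘ m<n⇒m<1+n)) (g≡0 ≤-refl)

sumBelow-single : ∀ w → m < w → (∀ {j} → j < w → j ≢ m → g j ≡ 0) → sumBelow w g ≡ g m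
sumBelow-single {m} {g} (suc w) m≤w others with m ≟ w
... | yes refl = cong (_+ g m) (sumBelow-zero m (λ j<m → others (m<n⇒m<1+n j<m) (<⇒≢ j<m)))
... | no m≢w = trans (cong₂ _+_ (sumBelow-single w (≤∧≢⇒< (≤-pred m≤w) m≢w) (others ∘ m<n⇒m<1+n))
                                (others ≤-refl (≢-sym m≢w)))
                     (+-identityʳ (g m))

sumBelow-fibre : ∀ w → All (λ a → f a < w) xs → sumBelow w (length ∘ fibre f xs) ≡ length xs
sumBelow-fibre w [] = sumBelow-zero w (λ _ → refl)
sumBelow-fibre {f} {a ∷ xs} w (fa<w ∷ xs<w) = begin
  sumBelow w (length ∘ fibre f (a ∷ xs))
    ≡⟨ sumBelow-+ w (λ j → trans (cong length (filter-++ (λ b → f b ≟ j) [ a ] xs))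
                                  (length-++ (fibre f [ a ] j))) ⟩
  sumBelow w (length ∘ fibre f [ a ]) + sumBelow w (length ∘ fibre f xs)
    ≡⟨ cong₂ _+_ (sumBelow-single w fa<w (λ _ j≢fa → cong length (filter-reject (λ b → f b ≟ _) (j≢fa ∘ sym))))
                 (sumBelow-fibre w xs<w) ⟩
  length (fibre f [ a ] (f a)) + length xs
    ≡⟨ cong (λ as → length as + length xs) (filter-accept (λ b → f b ≟ f a) refl) ⟩
  suc (length xs) ∎
  where open ≡-Reasoning

pigeonhole-singleton : ∀ w (g : ℕ → ℕ) → (∀ {j} → j < w → 1 ≤ g j) → sumBelow w g < w + w →
  ∃ λ j → j < w × g j ≡ 1
pigeonhole-singleton zero g _ ()
pigeonhole-singleton (suc w) g positive sum< with g w ≟ 1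
... | yes gw≡1 = w , ≤-refl , gw≡1
... | no gw≢1 with pigeonhole-singleton w g (positive ∘ m<n⇒m<1+n) sum<′
  where
    sum<′ : sumBelow w g < w + w
    sum<′ = +-cancelˡ-< 2 (sumBelow w g) (w + w) (begin-strict
      2 + sumBelow w g    ≡⟨ +-comm 2 (sumBelow w g) ⟩
      sumBelow w g + 2    ≤⟨ +-monoʳ-≤ (sumBelow w g) (≤∧≢⇒< (positive ≤-refl) (gw≢1 ∘ sym)) ⟩
      sumBelow w g + g w  <⟨ sum< ⟩
      suc w + suc w       ≡⟨ cong suc (+-suc w w) ⟩
      2 + (w + w)         ∎)
      where open ≤-Reasoning
...   | j , j<w , gj≡1 = j , m<n⇒m<1+n j<w , gj≡1

module _ {π w} (Λ : Levelling π w) where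
  open Levelling Λ

  private
    levels-↗ : IsIncSub π τ → AllPairs _<_ (map level τ)
    levels-↗ inc = LinkedP.Linked⇒AllPairs <-trans (LinkedP.map⁺ (level-increasing inc))

    levels-< : IsIncSub π τ → All (_< w) (map level τ)
    levels-< (τ⊆π , _) = AllP.map⁺ (All.tabulate (level-< ∘ SublistP.Any-resp-⊆ τ⊆π))

  incSub-length-≤ : IsIncSub π τ → length τ ≤ w
  incSub-length-≤ {τ} inc = subst (_≤ w) (trans (+-identityʳ _) (length-map level τ))
    (strictChain-length (levels-↗ inc) (All.tabulate (λ _ → z≤n)) (levels-< inc) z≤n)

  full-incSub-meets-level : IsIncSub π τ → length τ ≡ w → j < w → ∃ λ a → a ∈ τ × level a ≡ j
  full-incSub-meets-level {τ} inc full j<w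
    with ∈-map⁻ level (strictChain-∈ (levels-↗ inc) (All.tabulate (λ _ → z≤n)) (levels-< inc)
                         (trans (+-identityʳ _) (trans (length-map level τ) full)) z≤n j<w)
  ... | a , a∈τ , j≡ = a , a∈τ , sym j≡

  full-incSub⇒isLIS : IsIncSub π τ → length τ ≡ w → IsLIS π τ
  full-incSub⇒isLIS inc full = inc , λ τ′ inc′ → subst (length τ′ ≤_) (sym full) (incSub-length-≤ inc′)

  isLIS⇒length : IsLIS π τ → length τ ≡ w
  isLIS⇒length (inc , longest) with longChain
  ... | σ , σ-inc , σ-full = ≤-antisym (incSub-length-≤ inc) (subst (_≤ _) σ-full (longest σ σ-inc))

  singleton-fibre : length π < w + w → ∃₂ λ j p → j < w × fibre level π j ≡ [ p ]
  singleton-fibre short with longChain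
  ... | σ , σ-inc , σ-full with pigeonhole-singleton w (length ∘ fibre level π) nonempty
                                  (subst (_< w + w) (sym (sumBelow-fibre w (All.tabulate level-<))) short)
    where
      nonempty : j < w → 1 ≤ length (fibre level π j)
      nonempty {j} j<w with full-incSub-meets-level σ-inc σ-full j<w
      ... | a , a∈σ , a-level =
        ∈-length (∈-filter⁺ (λ b → level b ≟ j) (SublistP.Any-resp-⊆ (proj₁ σ-inc) a∈σ) a-level)
  ... | j , j<w , size≡1 with length≡1⇒singleton (fibre level π j) size≡1
  ...   | p , fibre≡[p] = j , p , j<w , fibre≡[p]

  fibre-singleton-∈ : fibre level π j ≡ [ p ] → p ∈ π
  fibre-singleton-∈ {j} {p} fibre≡[p] =
    proj₁ (∈-filter⁻ (λ b → level b ≟ j) (subst (p ∈_) (sym fibre≡[p]) (here refl)))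

  fibre-singleton-∈-LIS : j < w → fibre level π j ≡ [ p ] → ∀ τ → IsLIS π τ → p ∈ τ
  fibre-singleton-∈-LIS j<w fibre≡[p] τ lis@(inc , _) with full-incSub-meets-level inc (isLIS⇒length lis) j<w
  ... | a , a∈τ , a-level
    with subst (a ∈_) fibre≡[p] (∈-filter⁺ (λ b → level b ≟ _) (SublistP.Any-resp-⊆ (proj₁ inc) a∈τ) a-level)
  ...   | here refl = a∈τ

  delete-common-LIS-entry : p ∈ π → (∀ τ → IsLIS π τ → p ∈ τ) →
    ∃ λ σ → IsLIS (delete p π) σ × suc (length σ) ≡ w
  delete-common-LIS-entry {p} p∈π p∈LIS with longChain
  ... | σ , σ-inc@(σ⊆π , σ↗) , σ-full =
    delete p σ , (σ′-inc , σ′-longest) , trans (length-delete σ-unique p∈σ) σ-full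
    where
      p∈σ : p ∈ σ
      p∈σ = p∈LIS σ (full-incSub⇒isLIS σ-inc σ-full)
      σ-unique : Unique σ
      σ-unique = AllPairs.map <⇒≢ (LinkedP.Linked⇒AllPairs <-trans σ↗)
      σ′-inc : IsIncSub (delete p π) (delete p σ)
      σ′-inc = delete⁺ σ⊆π , LinkedP.filter⁺ (λ x → ¬? (x ≟ p)) <-trans σ↗
      σ′-longest : ∀ τ → IsIncSub (delete p π) τ → length τ ≤ length (delete p σ)
      σ′-longest τ (τ⊆ , τ↗) with m≤n⇒m<n∨m≡n (incSub-length-≤ (⊆-trans τ⊆ (delete-⊆ π) , τ↗))
      ... | inj₁ τ<w = ≤-pred (subst (length τ <_) (sym (trans (length-delete σ-unique p∈σ) σ-full)) τ<w)
      ... | inj₂ τ-full = ⊥-elim (∉-delete π (SublistP.Any-resp-⊆ τ⊆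
                              (p∈LIS τ (full-incSub⇒isLIS (⊆-trans τ⊆ (delete-⊆ π) , τ↗) τ-full))))

  critical-entry : length π < w + w →
    ∃ λ p → p ∈ π × (∃ λ σ → IsLIS (delete p π) σ × length σ ≡ w ∸ 1) × (∀ τ → IsLIS π τ → p ∈ τ)
  critical-entry short with singleton-fibre short
  ... | j , p , j<w , fibre≡[p]
    with p∈π ← fibre-singleton-∈ fibre≡[p]
       | p∈LIS ← fibre-singleton-∈-LIS j<w fibre≡[p]
    with delete-common-LIS-entry p∈π p∈LIS
  ... | σ , σ-lis , σ+1≡w = p , p∈π , (σ , σ-lis , cong (_∸ 1) σ+1≡w) , p∈LIS

perm-unique : ∀ {n} → IsPerm n π → Unique π
perm-unique {n = n} perm = Unique-resp-↭ (↭⇒↭ₛ (↭-sym perm)) (UniqueP.map⁺ suc-injective (UniqueP.upTo⁺ n))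

perm-∈-range : ∀ {n} → IsPerm n π → p ∈ π → 1 ≤ p × p ≤ n
perm-∈-range perm p∈π with ∈-map⁻ suc (∈-resp-↭ perm p∈π)
... | q , q∈ , refl = s≤s z≤n , ∈-upTo⁻ q∈

length-perm : ∀ {n} → IsPerm n π → length π ≡ n
length-perm {n = n} perm = trans (↭-length perm) (trans (length-map suc (upTo n)) (length-upTo n))

proposition23 : (s r : ℕ) → r < s → (π : List ℕ) → IsPerm (s + r) π →
    rsShape π ≡ twoRowShape s r →
    Σ ℕ (λ p → (1 ≤ p × p ≤ s + r)
      × Σ (List ℕ) (λ σ → IsLIS (delete p π) σ × length σ ≡ s ∸ 1)
      × (∀ τ → IsLIS π τ → p ∈ τ))
proposition23 s r r<s π perm shape =
  let p , p∈π , lis-after-deletion , p∈LIS = critical-entry Λ short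
  in  p , perm-∈-range perm p∈π , lis-after-deletion , p∈LIS
  where
    first-row-length : length (insertFirstRow π) ≡ s
    first-row-length = trans (cong length (sym (firstRow-insertionTableau π)))
                             (length-firstRow (insertionTableau π) shape)
    Λ : Levelling π s
    Λ = subst (Levelling π) first-row-length (schensted-levelling (perm-unique perm))
    short : length π < s + s
    short = subst (_< s + s) (sym (length-perm perm)) (+-monoʳ-< s r<s)
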